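{- Any marked hypergraph containing a nunchaku (as a subhypergraph) is a Maker win.
   Context: A marked hypergraph $H$: finite nonempty $V(H)$, edge set $E(H)$ of nonempty subsets of $V(H)$, marked set $M(H)\subseteq V(H)$. Subhypergraph $X$: $V(X)\subseteq V(H)$, $E(X)\subseteq E(H)$, $M(X)=V(X)\cap M(H)$. $H^{+x}$ marks non-marked $x$; $H^{ -y}$ deletes $y$ and all edges containing it. Trivial Maker win: some edge $e$ with $|e\setminus M(H)|\le1$. Maker win (recursive): if $|V(H)\setminus M(H)|\le1$, iff trivial Maker win; otherwise iff some non-marked $x$ has $H^{+x-y}$ a Maker win for all non-marked $y\ne x$. An $ab$-path of length $L\ge1$: edges $e_1,\dots,e_L$ (3-element sets), vertex set $\bigcup e_i$, $|e_i\cap e_{i+1}|=1$, $e_i\cap e_j=\varnothing$ for $|i-j|\ge2$, $a\ne b$, $a\in e_1\setminus\bigcup_{i\ge2}e_i$, $b\in e_L\setminus\bigcup_{i<L}e_i$. A nunchaku is a marked hypergraph that is an $ab$-path of positive length whose marked vertices are exactly $a$ and $b$. -}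

module Defs where

open import Data.Nat using (ℕ; zero; suc; _≤_; _<_; ∣_-_∣)
open import Data.Fin using (Fin; toℕ; fromℕ) renaming (zero to fzero)
open import Data.Fin.Subset using (Subset; _∈_; _∉_; _⊆_; _∩_; _∪_; _─_; ⁅_⁆; ∣_∣; Nonempty; Empty)
open import Data.Fin.Subset.Properties using (_∈?_)
open import Data.List using (List; filter)
open import Data.List.Membership.Propositional using () renaming (_∈_ to _∈ₗ_)
open import Data.List.Relation.Unary.All using (All)
open import Data.List.Relation.Unary.Any using (Any)
open import Data.Product using (Σ; ∃; _×_; _,_)
open import Relation.Nullary using (¬_; ¬?)
open import Relation.Binary.PropositionalEquality using (_≡_; _≢_)
open import Function.Bundles using (_⇔_)

record MHG (n : ℕ) : Set where
  constructor mhg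
  field
    V : Subset n
    E : List (Subset n)
    M : Subset n
open MHG public

IsMarkedHypergraph : ∀ {n} → MHG n → Set
IsMarkedHypergraph H =
  Nonempty (V H) × All (λ e → Nonempty e × e ⊆ V H) (E H) × M H ⊆ V H

Unmarked : ∀ {n} → MHG n → Subset n
Unmarked H = V H ─ M H

mark : ∀ {n} → MHG n → Fin n → MHG n
mark H x = mhg (V H) (E H) (M H ∪ ⁅ x ⁆)

delete : ∀ {n} → MHG n → Fin n → MHG n
delete H y = mhg (V H ─ ⁅ y ⁆) (filter (λ e → ¬? (y ∈? e)) (E H)) (M H ─ ⁅ y ⁆)

TrivialMakerWin : ∀ {n} → MHG n → Set
TrivialMakerWin H = Any (λ e → ∣ e ─ M H ∣ ≤ 1) (E H)

-- Maker win, as the (well-founded) recursive definition: least fixed point.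
data MakerWin {n : ℕ} (H : MHG n) : Set where
  base : ∣ Unmarked H ∣ ≤ 1 → TrivialMakerWin H → MakerWin H
  step : 1 < ∣ Unmarked H ∣ → (x : Fin n) → x ∈ Unmarked H →
         (∀ (y : Fin n) → y ∈ Unmarked H → y ≢ x → MakerWin (delete (mark H x) y)) →
         MakerWin H

Subhypergraph : ∀ {n} → MHG n → MHG n → Set
Subhypergraph X H =
  V X ⊆ V H × (∀ e → e ∈ₗ E X → e ∈ₗ E H) × M X ≡ V X ∩ M H

-- es : Fin L → Subset n (edges e_1..e_L, L = suc k) form an ab-path
IsPath : ∀ {n} (a b : Fin n) (k : ℕ) (es : Fin (suc k) → Subset n) → Set
IsPath {n} a b k es =
    (∀ i → ∣ es i ∣ ≡ 3)
  × (∀ i j → toℕ j ≡ suc (toℕ i) → ∣ es i ∩ es j ∣ ≡ 1)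
  × (∀ i j → 2 ≤ ∣ toℕ i - toℕ j ∣ → Empty (es i ∩ es j))
  × a ≢ b
  × a ∈ es fzero × (∀ i → 1 ≤ toℕ i → a ∉ es i)
  × b ∈ es (fromℕ k) × (∀ i → toℕ i < k → b ∉ es i)

IsNunchaku : ∀ {n} → MHG n → Set
IsNunchaku {n} X =
  Σ (Fin n) λ a → Σ (Fin n) λ b → Σ ℕ λ k → Σ (Fin (suc k) → Subset n) λ es →
      IsPath a b k es
    × (∀ v → (v ∈ V X) ⇔ (∃ λ i → v ∈ es i))
    × (∀ e → (e ∈ₗ E X) ⇔ (∃ λ i → es i ≡ e))
    × M X ≡ ⁅ a ⁆ ∪ ⁅ b ⁆

-- An edge with at most one unmarked vertex d is already a Maker win: Maker claims d while it
-- is available, so Breaker can never delete that edge.  For a nunchaku with edges e₀, e₁, …,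
-- Maker claims the vertex c shared by e₀ and e₁.  If Breaker deletes the third vertex d of e₀,
-- the remaining edges form a shorter nunchaku with marked ends c and b; otherwise e₀ keeps
-- only d unmarked.
module Submission where

open import Defs

open import Data.Nat using (ℕ; zero; suc; _≤_; _<_; z≤n; s≤s; _≤?_) renaming (∣_-_∣ to dist)
open import Data.Nat.Properties using (≤-refl; ≤-trans; <-≤-trans; ≤-pred; ≰⇒>; suc-injective)
open import Data.Product using (Σ; ∃; _×_; _,_; proj₁; proj₂)
open import Data.Sum using (_⊎_; inj₁; inj₂; [_,_]′) renaming (map to ⊎-map)
open import Data.Vec using (_∷_; here; there)
open import Data.Fin using (Fin; toℕ; fromℕ) renaming (zero to fzero; suc to fsuc)
open import Data.Fin.Properties using (_≟_)
open import Data.Fin.Subset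
  using (Subset; _∈_; _∉_; _⊆_; _─_; _-_; _∪_; _∩_; Empty; ⁅_⁆; ∣_∣; Nonempty; inside; outside)
open import Data.Fin.Subset.Properties
  using (p─⊥≡p; x∈p∧x≢y⇒x∈p-y; x∉⁅y⁆⇒x≢y; p─q⊆p; x∈p∧x∉q⇒x∈p─q; x∈⁅x⁆; x∈⁅y⁆⇒x≡y; ∣⁅x⁆∣≡1;
         p⊆q⇒∣p∣≤∣q∣; x∈p∩q⁺; x∈p∩q⁻; x∈p∪q⁺; x∈p∪q⁻; x∈p⇒∣p-x∣<∣p∣; _∈?_)
open import Relation.Nullary using (yes; no; ¬?)
open import Data.Empty using (⊥-elim)
open import Data.List.Membership.Propositional using (lose) renaming (_∈_ to _∈ₗ_)
open import Data.List.Membership.Propositional.Properties using (∈-filter⁺)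
open import Function using (_∘_; case_of_)
open import Function.Bundles using (Equivalence)
open import Relation.Binary.PropositionalEquality using (_≡_; _≢_; refl; sym; cong; subst; module ≡-Reasoning)

private variable
  n : ℕ
  p q : Subset n
  x y : Fin n

x∈p─q⇒x∉q : x ∈ p ─ q → x ∉ q
x∈p─q⇒x∉q {p = _ ∷ _} {q = outside ∷ _} here ()
x∈p─q⇒x∉q {p = _ ∷ _} {q = _ ∷ _} (there x∈p─q) (there x∈q) = x∈p─q⇒x∉q x∈p─q x∈q

∣p∣≡1+∣p-x∣ : x ∈ p → ∣ p ∣ ≡ suc ∣ p - x ∣
∣p∣≡1+∣p-x∣ {p = inside ∷ p} here = cong (λ r → suc ∣ r ∣) (sym (p─⊥≡p p))
∣p∣≡1+∣p-x∣ {p = inside ∷ _} (there x∈p) = cong suc (∣p∣≡1+∣p-x∣ x∈p)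
∣p∣≡1+∣p-x∣ {p = outside ∷ _} (there x∈p) = ∣p∣≡1+∣p-x∣ x∈p

x∈p⇒0<∣p∣ : x ∈ p → 0 < ∣ p ∣
x∈p⇒0<∣p∣ x∈p rewrite ∣p∣≡1+∣p-x∣ x∈p = s≤s z≤n

0<∣p∣⇒Nonempty : 0 < ∣ p ∣ → Nonempty p
0<∣p∣⇒Nonempty {p = inside ∷ _} _ = fzero , here
0<∣p∣⇒Nonempty {p = outside ∷ _} 0<∣p∣ with 0<∣p∣⇒Nonempty 0<∣p∣
... | x , x∈p = fsuc x , there x∈p

x∈p∧y∈p∧x≢y⇒1<∣p∣ : x ∈ p → y ∈ p → x ≢ y → 1 < ∣ p ∣
x∈p∧y∈p∧x≢y⇒1<∣p∣ x∈p y∈p x≢y rewrite ∣p∣≡1+∣p-x∣ x∈p =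
  s≤s (x∈p⇒0<∣p∣ (x∈p∧x≢y⇒x∈p-y y∈p (x≢y ∘ sym)))

∣p∣≤1∧x∈p∧y∈p⇒x≡y : ∣ p ∣ ≤ 1 → x ∈ p → y ∈ p → x ≡ y
∣p∣≤1∧x∈p∧y∈p⇒x≡y {x = x} {y = y} ∣p∣≤1 x∈p y∈p with x ≟ y
... | yes x≡y = x≡y
... | no x≢y with ≤-trans (x∈p∧y∈p∧x≢y⇒1<∣p∣ x∈p y∈p x≢y) ∣p∣≤1
...   | s≤s ()

third-element : ∣ p ∣ ≡ 3 → x ∈ p → y ∈ p → x ≢ y →
  ∃ λ z → z ∈ p × z ≢ x × z ≢ y × (∀ {w} → w ∈ p → w ≡ x ⊎ w ≡ y ⊎ w ≡ z)
third-element {p = p} {x = x} {y = y} ∣p∣≡3 x∈p y∈p x≢y =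
  z , z∈p , x∉⁅y⁆⇒x≢y (x∈p─q⇒x∉q z∈p-x) , x∉⁅y⁆⇒x≢y (x∈p─q⇒x∉q z∈r) , classify
  where
  y∈p-x : y ∈ p - x
  y∈p-x = x∈p∧x≢y⇒x∈p-y y∈p (x≢y ∘ sym)
  ∣r∣≡1 : ∣ p - x - y ∣ ≡ 1
  ∣r∣≡1 = suc-injective (suc-injective (begin
    suc (suc ∣ p - x - y ∣)  ≡⟨ cong suc (∣p∣≡1+∣p-x∣ y∈p-x) ⟨
    suc ∣ p - x ∣            ≡⟨ ∣p∣≡1+∣p-x∣ x∈p ⟨
    ∣ p ∣                    ≡⟨ ∣p∣≡3 ⟩
    3                        ∎))
    where open ≡-Reasoning
  r-nonempty : Nonempty (p - x - y)
  r-nonempty = 0<∣p∣⇒Nonempty (subst (0 <_) (sym ∣r∣≡1) (s≤s z≤n))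
  z = proj₁ r-nonempty
  z∈r = proj₂ r-nonempty
  z∈p-x : z ∈ p - x
  z∈p-x = p─q⊆p _ _ z∈r
  z∈p : z ∈ p
  z∈p = p─q⊆p _ _ z∈p-x
  classify : ∀ {w} → w ∈ p → w ≡ x ⊎ w ≡ y ⊎ w ≡ z
  classify {w} w∈p with w ≟ x | w ≟ y
  ... | yes w≡x | _ = inj₁ w≡x
  ... | no _ | yes w≡y = inj₂ (inj₁ w≡y)
  ... | no w≢x | no w≢y = inj₂ (inj₂ (∣p∣≤1∧x∈p∧y∈p⇒x≡y (subst (_≤ 1) (sym ∣r∣≡1) (s≤s z≤n))
                              (x∈p∧x≢y⇒x∈p-y (x∈p∧x≢y⇒x∈p-y w∈p w≢x) w≢y) z∈r))

play : MHG n → Fin n → Fin n → MHG n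
play H x y = delete (mark H x) y

module _ (H : MHG n) (x y : Fin n) where

  Unmarked-play⊆ : Unmarked (play H x y) ⊆ Unmarked H - x
  Unmarked-play⊆ {w} w∈ =
    x∈p∧x∉q⇒x∈p─q (x∈p∧x∉q⇒x∈p─q w∈V (w∉M ∘ x∈p∪q⁺ ∘ inj₁)) (w∉M ∘ x∈p∪q⁺ ∘ inj₂)
    where
    w∈V-y : w ∈ V H ─ ⁅ y ⁆
    w∈V-y = p─q⊆p _ _ w∈
    w∈V : w ∈ V H
    w∈V = p─q⊆p _ _ w∈V-y
    w∉M : w ∉ M H ∪ ⁅ x ⁆
    w∉M w∈M = x∈p─q⇒x∉q w∈ (x∈p∧x∉q⇒x∈p─q w∈M (x∈p─q⇒x∉q w∈V-y))

  ∣Unmarked-play∣< : x ∈ Unmarked H → ∣ Unmarked (play H x y) ∣ < ∣ Unmarked H ∣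
  ∣Unmarked-play∣< x∈U = <-≤-trans (s≤s (p⊆q⇒∣p∣≤∣q∣ Unmarked-play⊆)) (x∈p⇒∣p-x∣<∣p∣ x∈U)

  ∈V-play⁺ : ∀ {w} → w ∈ V H → w ≢ y → w ∈ V (play H x y)
  ∈V-play⁺ w∈V w≢y = x∈p∧x≢y⇒x∈p-y w∈V w≢y

  ∈M-play⁺ : ∀ {w} → w ∈ M H → w ≢ y → w ∈ M (play H x y)
  ∈M-play⁺ w∈M w≢y = x∈p∧x≢y⇒x∈p-y (x∈p∪q⁺ (inj₁ w∈M)) w≢y

  x∈M-play : x ≢ y → x ∈ M (play H x y)
  x∈M-play x≢y = x∈p∧x≢y⇒x∈p-y (x∈p∪q⁺ (inj₂ (x∈⁅x⁆ x))) x≢y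

  ∈M-play⁻ : ∀ {w} → w ∈ M (play H x y) → w ∈ M H ⊎ w ≡ x
  ∈M-play⁻ w∈ with x∈p∪q⁻ (M H) ⁅ x ⁆ (p─q⊆p _ _ w∈)
  ... | inj₁ w∈M = inj₁ w∈M
  ... | inj₂ w∈⁅x⁆ = inj₂ (x∈⁅y⁆⇒x≡y x w∈⁅x⁆)

  ∈E-play⁺ : ∀ {e} → e ∈ₗ E H → y ∉ e → e ∈ₗ E (play H x y)
  ∈E-play⁺ e∈E y∉e = ∈-filter⁺ (λ e → ¬? (y ∈? e)) e∈E y∉e

MarkedExcept : MHG n → Subset n → Fin n → Set
MarkedExcept H e z = ∀ {w} → w ∈ e → w ∈ M H ⊎ w ≡ z

markedExcept⇒TrivialMakerWin : ∀ {H : MHG n} {e z} →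
  e ∈ₗ E H → MarkedExcept H e z → TrivialMakerWin H
markedExcept⇒TrivialMakerWin {H = H} {e} {z} e∈E e-marked =
  lose e∈E (subst (∣ e ─ M H ∣ ≤_) (∣⁅x⁆∣≡1 z) (p⊆q⇒∣p∣≤∣q∣ unmarked⊆⁅z⁆))
  where
  unmarked⊆⁅z⁆ : e ─ M H ⊆ ⁅ z ⁆
  unmarked⊆⁅z⁆ w∈ with e-marked (p─q⊆p _ _ w∈)
  ... | inj₁ w∈M = ⊥-elim (x∈p─q⇒x∉q w∈ w∈M)
  ... | inj₂ refl = x∈⁅x⁆ z

preferred-move : ∀ (H : MHG n) (z : Fin n) → Nonempty (Unmarked H) →
  ∃ λ x → x ∈ Unmarked H × (∀ {y} → y ∈ Unmarked H → y ≢ x → y ≢ z)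
preferred-move H z (v , v∈U) with z ∈? Unmarked H
... | yes z∈U = z , z∈U , λ _ y≢z → y≢z
... | no z∉U = v , v∈U , λ y∈U _ y≡z → z∉U (subst (_∈ Unmarked H) y≡z y∈U)

markedExcept⇒MakerWin : ∀ {H : MHG n} {e z} → e ∈ₗ E H → MarkedExcept H e z → MakerWin H
markedExcept⇒MakerWin {H = H} = bounded ∣ Unmarked H ∣ ≤-refl
  where
  bounded : ∀ m {H e z} → ∣ Unmarked H ∣ ≤ m → e ∈ₗ E H → MarkedExcept H e z → MakerWin H
  bounded m {H} {z = z} bound e∈E e-marked with ∣ Unmarked H ∣ ≤? 1
  ... | yes ∣U∣≤1 = base ∣U∣≤1 (markedExcept⇒TrivialMakerWin {H = H} e∈E e-marked)
  bounded zero bound _ _ | no ∣U∣≰1 = ⊥-elim (∣U∣≰1 (≤-trans bound z≤n))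
  bounded (suc m) {H} {e} {z} bound e∈E e-marked | no ∣U∣≰1 = step 1<∣U∣ move move∈U breaker
    where
    1<∣U∣ = ≰⇒> ∣U∣≰1
    choice = preferred-move H z (0<∣p∣⇒Nonempty (≤-trans (s≤s z≤n) 1<∣U∣))
    move = proj₁ choice
    move∈U = proj₁ (proj₂ choice)
    breaker : ∀ y → y ∈ Unmarked H → y ≢ move → MakerWin (play H move y)
    breaker y y∈U y≢move =
      bounded m (≤-pred (≤-trans (∣Unmarked-play∣< H move y move∈U) bound))
                (∈E-play⁺ H move y e∈E y∉e) still-marked
      where
      y∉e : y ∉ e
      y∉e y∈e with e-marked y∈e
      ... | inj₁ y∈M = x∈p─q⇒x∉q y∈U y∈M
      ... | inj₂ y≡z = proj₂ (proj₂ choice) y∈U y≢move y≡z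
      still-marked : MarkedExcept (play H move y) e z
      still-marked w∈e with e-marked w∈e
      ... | inj₁ w∈M = inj₁ (∈M-play⁺ H move y w∈M (λ w≡y → y∉e (subst (_∈ e) w≡y w∈e)))
      ... | inj₂ w≡z = inj₂ w≡z

record NunchakuIn (H : MHG n) (a b : Fin n) (k : ℕ) (es : Fin (suc k) → Subset n) : Set where
  field
    edge-size        : ∀ i → ∣ es i ∣ ≡ 3
    consecutive-meet : ∀ i j → toℕ j ≡ suc (toℕ i) → ∣ es i ∩ es j ∣ ≡ 1
    distant-disjoint : ∀ i j → 2 ≤ dist (toℕ i) (toℕ j) → Empty (es i ∩ es j)
    ends-distinct    : a ≢ b
    a∈first          : a ∈ es fzero
    a∉rest           : ∀ i → 1 ≤ toℕ i → a ∉ es i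
    b∈last           : b ∈ es (fromℕ k)
    b∉init           : ∀ i → toℕ i < k → b ∉ es i
    edge∈E           : ∀ i → es i ∈ₗ E H
    edge⊆V           : ∀ i → es i ⊆ V H
    a∈M              : a ∈ M H
    b∈M              : b ∈ M H
    marked⇒end       : ∀ i {w} → w ∈ es i → w ∈ M H → w ≡ a ⊎ w ≡ b

module FirstEdge {H : MHG n} {a b : Fin n} {k : ℕ} {es : Fin (suc (suc k)) → Subset n}
                 (N : NunchakuIn H a b (suc k) es) where
  open NunchakuIn N

  e₀ e₁ : Subset n
  e₀ = es fzero
  e₁ = es (fsuc fzero)

  ∣e₀∩e₁∣≡1 : ∣ e₀ ∩ e₁ ∣ ≡ 1
  ∣e₀∩e₁∣≡1 = consecutive-meet fzero (fsuc fzero) refl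

  joint : Nonempty (e₀ ∩ e₁)
  joint = 0<∣p∣⇒Nonempty (subst (0 <_) (sym ∣e₀∩e₁∣≡1) (s≤s z≤n))

  c : Fin n
  c = proj₁ joint

  c∈e₀ : c ∈ e₀
  c∈e₀ = proj₁ (x∈p∩q⁻ e₀ e₁ (proj₂ joint))

  c∈e₁ : c ∈ e₁
  c∈e₁ = proj₂ (x∈p∩q⁻ e₀ e₁ (proj₂ joint))

  a≢c : a ≢ c
  a≢c a≡c = a∉rest (fsuc fzero) (s≤s z≤n) (subst (_∈ e₁) (sym a≡c) c∈e₁)

  third : ∃ λ z → z ∈ e₀ × z ≢ a × z ≢ c × (∀ {w} → w ∈ e₀ → w ≡ a ⊎ w ≡ c ⊎ w ≡ z)
  third = third-element (edge-size fzero) a∈first c∈e₀ a≢c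

  d : Fin n
  d = proj₁ third

  d∈e₀ : d ∈ e₀
  d∈e₀ = proj₁ (proj₂ third)

  d≢a : d ≢ a
  d≢a = proj₁ (proj₂ (proj₂ third))

  d≢c : d ≢ c
  d≢c = proj₁ (proj₂ (proj₂ (proj₂ third)))

  e₀⊆acd : ∀ {w} → w ∈ e₀ → w ≡ a ⊎ w ≡ c ⊎ w ≡ d
  e₀⊆acd = proj₂ (proj₂ (proj₂ (proj₂ third)))

  b∉e₀ : b ∉ e₀
  b∉e₀ = b∉init fzero (s≤s z≤n)

  e₀-unmarked : ∀ {w} → w ∈ e₀ → w ≢ a → w ∈ Unmarked H
  e₀-unmarked w∈e₀ w≢a = x∈p∧x∉q⇒x∈p─q (edge⊆V fzero w∈e₀) λ w∈M →
    [ w≢a , (λ { refl → b∉e₀ w∈e₀ }) ]′ (marked⇒end fzero w∈e₀ w∈M)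

  c∈U : c ∈ Unmarked H
  c∈U = e₀-unmarked c∈e₀ (a≢c ∘ sym)

  d∈U : d ∈ Unmarked H
  d∈U = e₀-unmarked d∈e₀ d≢a

  1<∣U∣ : 1 < ∣ Unmarked H ∣
  1<∣U∣ = x∈p∧y∈p∧x≢y⇒1<∣p∣ c∈U d∈U (d≢c ∘ sym)

  meets-e₀⇒first : ∀ i {w} → w ∈ e₀ → w ∈ es (fsuc i) → i ≡ fzero
  meets-e₀⇒first fzero _ _ = refl
  meets-e₀⇒first (fsuc i) {w} w∈e₀ w∈e = ⊥-elim
    (distant-disjoint fzero (fsuc (fsuc i)) (s≤s (s≤s z≤n)) (w , x∈p∩q⁺ (w∈e₀ , w∈e)))

  d∉tail : ∀ i → d ∉ es (fsuc i)
  d∉tail i d∈e with meets-e₀⇒first i d∈e₀ d∈e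
  ... | refl = d≢c (∣p∣≤1∧x∈p∧y∈p⇒x≡y (subst (_≤ 1) (sym ∣e₀∩e₁∣≡1) ≤-refl)
                     (x∈p∩q⁺ (d∈e₀ , d∈e)) (x∈p∩q⁺ (c∈e₀ , c∈e₁)))

  c∉tail : ∀ i → 1 ≤ toℕ i → c ∉ es (fsuc i)
  c∉tail i 1≤i c∈e with meets-e₀⇒first i c∈e₀ c∈e
  c∉tail .fzero () c∈e | refl

  shorten : NunchakuIn (play H c d) c b k (es ∘ fsuc)
  shorten = record
    { edge-size        = edge-size ∘ fsuc
    ; consecutive-meet = λ i j j≡1+i → consecutive-meet (fsuc i) (fsuc j) (cong suc j≡1+i)
    ; distant-disjoint = λ i j → distant-disjoint (fsuc i) (fsuc j)
    ; ends-distinct    = λ c≡b → b∉e₀ (subst (_∈ e₀) c≡b c∈e₀)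
    ; a∈first          = c∈e₁
    ; a∉rest           = c∉tail
    ; b∈last           = b∈last
    ; b∉init           = λ i i<k → b∉init (fsuc i) (s≤s i<k)
    ; edge∈E           = λ i → ∈E-play⁺ H c d (edge∈E (fsuc i)) (d∉tail i)
    ; edge⊆V           = λ i w∈e → ∈V-play⁺ H c d (edge⊆V (fsuc i) w∈e) (λ { refl → d∉tail i w∈e })
    ; a∈M              = x∈M-play H c d (d≢c ∘ sym)
    ; b∈M              = ∈M-play⁺ H c d b∈M (λ b≡d → x∈p─q⇒x∉q d∈U (subst (_∈ M H) b≡d b∈M))
    ; marked⇒end       = λ i w∈e w∈M → case ∈M-play⁻ H c d w∈M of λ
        { (inj₁ w∈M) → [ (λ { refl → ⊥-elim (a∉rest (fsuc i) (s≤s z≤n) w∈e) }) , inj₂ ]′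
                          (marked⇒end (fsuc i) w∈e w∈M)
        ; (inj₂ w≡c) → inj₁ w≡c
        }
    }

  e₀∈E-play : ∀ {y} → y ∈ Unmarked H → y ≢ c → y ≢ d → e₀ ∈ₗ E (play H c y)
  e₀∈E-play {y} y∈U y≢c y≢d = ∈E-play⁺ H c y (edge∈E fzero) λ y∈e₀ →
    [ (λ { refl → x∈p─q⇒x∉q y∈U a∈M }) , [ y≢c , y≢d ]′ ]′ (e₀⊆acd y∈e₀)

  e₀-marked-play : ∀ {y} → y ∈ Unmarked H → y ≢ c → MarkedExcept (play H c y) e₀ d
  e₀-marked-play {y} y∈U y≢c w∈e₀ with e₀⊆acd w∈e₀
  ... | inj₁ refl = inj₁ (∈M-play⁺ H c y a∈M (λ { refl → x∈p─q⇒x∉q y∈U a∈M }))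
  ... | inj₂ (inj₁ refl) = inj₁ (x∈M-play H c y (y≢c ∘ sym))
  ... | inj₂ (inj₂ w≡d) = inj₂ w≡d

nunchakuIn⇒MakerWin : ∀ k {H : MHG n} {a b es} → NunchakuIn H a b k es → MakerWin H
nunchakuIn⇒MakerWin zero N =
  let open NunchakuIn N
      (d , _ , _ , _ , e₀⊆abd) = third-element (edge-size fzero) a∈first b∈last ends-distinct
  in markedExcept⇒MakerWin (edge∈E fzero) λ w∈e₀ → case e₀⊆abd w∈e₀ of λ
       { (inj₁ refl)        → inj₁ a∈M
       ; (inj₂ (inj₁ refl)) → inj₁ b∈M
       ; (inj₂ (inj₂ w≡d))  → inj₂ w≡d
       }
nunchakuIn⇒MakerWin (suc k) {H} N = step 1<∣U∣ c c∈U breaker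
  where
  open FirstEdge N
  breaker : ∀ y → y ∈ Unmarked H → y ≢ c → MakerWin (play H c y)
  breaker y y∈U y≢c with y ≟ d
  ... | yes refl = nunchakuIn⇒MakerWin k shorten
  ... | no y≢d = markedExcept⇒MakerWin (e₀∈E-play y∈U y≢c y≢d) (e₀-marked-play y∈U y≢c)

module _ {X H : MHG n} (X⊆H : Subhypergraph X H) where
  open Equivalence

  nunchaku⇒NunchakuIn : IsNunchaku X →
    ∃ λ a → ∃ λ b → ∃ λ k → ∃ λ (es : Fin (suc k) → Subset n) → NunchakuIn H a b k es
  nunchaku⇒NunchakuIn
    (a , b , k , es , (size , meet , disjoint , a≢b , a∈ , a∉ , b∈ , b∉) , V-X , E-X , M-X) =
    a , b , k , es , record
      { edge-size        = size
      ; consecutive-meet = meet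
      ; distant-disjoint = disjoint
      ; ends-distinct    = a≢b
      ; a∈first          = a∈
      ; a∉rest           = a∉
      ; b∈last           = b∈
      ; b∉init           = b∉
      ; edge∈E           = λ i → E-X⊆E-H (es i) (from (E-X (es i)) (i , refl))
      ; edge⊆V           = λ i w∈e → V-X⊆V-H (from (V-X _) (i , w∈e))
      ; a∈M              = M-X⊆M-H (subst (a ∈_) (sym M-X) (x∈p∪q⁺ (inj₁ (x∈⁅x⁆ a))))
      ; b∈M              = M-X⊆M-H (subst (b ∈_) (sym M-X) (x∈p∪q⁺ (inj₂ (x∈⁅x⁆ b))))
      ; marked⇒end       = λ i w∈e w∈M → end (subst (_ ∈_) M-X (∈M-X (from (V-X _) (i , w∈e)) w∈M))
      }
    where
    V-X⊆V-H = proj₁ X⊆H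
    E-X⊆E-H = proj₁ (proj₂ X⊆H)
    M-X≡ = proj₂ (proj₂ X⊆H)
    M-X⊆M-H : ∀ {w} → w ∈ M X → w ∈ M H
    M-X⊆M-H {w} w∈ = proj₂ (x∈p∩q⁻ (V X) (M H) (subst (w ∈_) M-X≡ w∈))
    ∈M-X : ∀ {w} → w ∈ V X → w ∈ M H → w ∈ M X
    ∈M-X {w} w∈V w∈M = subst (w ∈_) (sym M-X≡) (x∈p∩q⁺ (w∈V , w∈M))
    end : ∀ {w} → w ∈ ⁅ a ⁆ ∪ ⁅ b ⁆ → w ≡ a ⊎ w ≡ b
    end w∈ = ⊎-map (x∈⁅y⁆⇒x≡y a) (x∈⁅y⁆⇒x≡y b) (x∈p∪q⁻ ⁅ a ⁆ ⁅ b ⁆ w∈)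

mainTheorem10 : ∀ (n : ℕ) (H : MHG n) → IsMarkedHypergraph H →
    Σ (MHG n) (λ X → Subhypergraph X H × IsNunchaku X) → MakerWin H
mainTheorem10 n H _ (X , X⊆H , X-nunchaku) =
  let (_ , _ , k , _ , N) = nunchaku⇒NunchakuIn X⊆H X-nunchaku
  in nunchakuIn⇒MakerWin k N
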